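{- For every integer $k>1$, the generalised ant with rule word $L^{2k}R$ (i.e. $2k$ letters $L$ followed by one letter $R$) admits at least two different highways: a fundamental highway of period $16k+2$ and drift $(\pm1,\pm1)$, and a harmonic highway of period $32k+4$ and drift $(\pm2,\pm2)$.
   Context: A generalised ant with rule word $w=w_0w_1\cdots w_{|w|-1}\in\{L,R\}^+$ has state set $Q=\{\rightarrow,\uparrow,\leftarrow,\downarrow\}$ (the four unit vectors of $\mathbb{Z}^2$) and alphabet $A=\{0,1,\dots,|w|-1\}=\mathbb{Z}/|w|\mathbb{Z}$. A configuration is $(C,(i,j),d)\in A^{\mathbb{Z}^2}\times\mathbb{Z}^2\times Q$ (picture, ant position, ant direction). The transition $T_w(C,(i,j),d)=(C',(i',j'),d')$ is: $C'(i,j)=C(i,j)+1 \bmod |w|$ and $C'(k,l)=C(k,l)$ for $(k,l)\neq(i,j)$; $d'$ is $d$ rotated by $90^\circ$ clockwise if $w_{C(i,j)}=R$ and counterclockwise if $w_{C(i,j)}=L$; $(i',j')=(i,j)+d'$. A pattern is a map $P:S\to A$ with $S\subseteq\mathbb{Z}^2$ finite (its support); $T_w$ is applied to $(P,(i,j),d)$ by the same rule, provided $(i,j)\in S$. A highway of period $N$ and drift $(a,b)\in\mathbb{Z}^2$ of the ant $w$ is given by a pattern $P$ with support $S$, a position $(i,j)\in S$ and a direction $d$ such that $T_w$ can be applied $N$ times starting from $(P,(i,j),d)$ (the ant stays in $S$ before each application), the resulting pattern $T_w^N(P)$ has the ant at position $(i,j)+(a,b)$ with direction $d$, and for all $(x,y)\in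 S$: $P(x,y)=T_w^N(P)(x+a,y+b)$ if $(x+a,y+b)\in S$, and $P(x,y)=0$ otherwise. Highways obtained from one another by rotation, translation, or by choosing another pattern along the same periodic evolution are regarded as the same highway; the trace of an ant is the sequence of symbols it reads along its evolution. -}

module Defs where

open import Data.Nat as ℕ using (ℕ; zero; suc; _<_; _≡ᵇ_; _*_)
open import Data.Nat.DivMod using (_mod_)
open import Data.Integer as ℤ using (ℤ; +_; -_)
open import Data.Fin using (Fin; toℕ)
import Data.Fin
open import Data.Product using (Σ; ∃; ∃-syntax; _×_; _,_; proj₁; proj₂)
open import Data.Product.Properties using (≡-dec)
open import Data.Bool using (if_then_else_)
open import Data.List using (List)
open import Data.List.Membership.Propositional using (_∈_)
import Data.List.Membership.DecPropositional as DecMem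
open import Relation.Nullary using (¬_; does)
open import Relation.Binary.Definitions using (DecidableEquality)
open import Relation.Binary.PropositionalEquality using (_≡_)

Pos : Set
Pos = ℤ × ℤ

_+ₚ_ : Pos → Pos → Pos
(x , y) +ₚ (x' , y') = (x ℤ.+ x' , y ℤ.+ y')

_≟ₚ_ : DecidableEquality Pos
_≟ₚ_ = ≡-dec ℤ._≟_ ℤ._≟_

open DecMem _≟ₚ_ using (_∈?_)

data Dir : Set where
  right up left down : Dir

unit : Dir → Pos
unit right = (+ 1 , + 0)
unit up    = (+ 0 , + 1)
unit left  = (- (+ 1) , + 0)
unit down  = (+ 0 , - (+ 1))

cw : Dir → Dir
cw right = down
cw down  = left
cw left  = up
cw up    = right

ccw : Dir → Dir
ccw right = up
ccw up    = left
ccw left  = down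
ccw down  = right

data Turn : Set where
  L R : Turn

turn : Turn → Dir → Dir
turn R d = cw d
turn L d = ccw d

LR : (k : ℕ) → Fin (suc (2 * k)) → Turn
LR k i = if toℕ i ≡ᵇ 2 * k then R else L

-- 90° clockwise rotation of the plane (maps unit d to unit (cw d))
rotP : Pos → Pos
rotP (x , y) = (y , - x)

iter : {X : Set} → ℕ → (X → X) → X → X
iter zero    f x = x
iter (suc t) f x = f (iter t f x)

module _ (n : ℕ) (w : Fin (suc n) → Turn) where

  A : Set
  A = Fin (suc n)

  Config : Set
  Config = (Pos → A) × Pos × Dir

  incr : A → A
  incr a = suc (toℕ a) mod (suc n)

  update : (Pos → A) → Pos → A → (Pos → A)
  update C p a x = if does (x ≟ₚ p) then a else C x

  step : Config → Config
  step (C , p , d) =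
    let a  = C p
        d' = turn (w a) d
    in (update C p (incr a) , p +ₚ unit d' , d')

  run : ℕ → Config → Config
  run t = iter t step

  picOf : Config → Pos → A
  picOf c = proj₁ c

  posOf : Config → Pos
  posOf c = proj₁ (proj₂ c)

  dirOf : Config → Dir
  dirOf c = proj₂ (proj₂ c)

  -- A highway: pat P with support S (a finite list), a position and a
  -- direction, period N and drift (a,b). Values of 'pat' outside the
  -- support are irrelevant (the ant only reads cells of S).
  record Highway : Set where
    field
      support : List Pos
      pat : Pos → A
      start   : Pos
      dir     : Dir
      period  : ℕ
      drift   : Pos
      startIn : start ∈ support
      inside  : ∀ t → t < period →
                posOf (run t (pat , start , dir)) ∈ support
      returnPos : posOf (run period (pat , start , dir)) ≡ start +ₚ drift
      returnDir : dirOf (run period (pat , start , dir)) ≡ dir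
      shift   : ∀ x → x ∈ support →
                ((x +ₚ drift) ∈ support →
                   pat x ≡ picOf (run period (pat , start , dir)) (x +ₚ drift))
                × (¬ ((x +ₚ drift) ∈ support) → pat x ≡ Data.Fin.zero)

  open Highway public

  extend : Highway → Pos → A
  extend H x = if does (x ∈? support H) then pat H x else Data.Fin.zero

  obs : Highway → ℕ → Pos × Dir × A
  obs H t =
    let c = run t (extend H , start H , dir H)
    in (posOf c , dirOf c , picOf c (posOf c))

  transform : Fin 4 → Pos → Pos × Dir × A → Pos × Dir × A
  transform r v (p , d , a) = (iter (toℕ r) rotP p +ₚ v , iter (toℕ r) cw d , a)

  -- Two highways are the same if their evolutions agree up to rotation,
  -- translation and a shift in time (i.e. choice of pat along the evolution).
  SameHighway : Highway → Highway → Set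
  SameHighway H₁ H₂ =
    ∃[ r ] ∃[ v ] ∃[ s₁ ] ∃[ s₂ ]
      (∀ t → obs H₁ (s₁ ℕ.+ t) ≡ transform r v (obs H₂ (s₂ ℕ.+ t)))

-- A blank cell that the ant has visited c times carries c mod (2k+1), and L²ᵏR turns right exactly
-- when it reads 2k; so configurations can be described by visit counts and runs followed symbolically
-- in k.  On both highways the ant mostly circles unit squares, turning left while the four counts stay
-- below 2k, with a few single turns in between; after 16k+2, resp. 32k+4, steps the initial pattern
-- reappears shifted by (1,1), resp. (2,2).
-- The trace (the sequence of symbols read) of a highway is periodic with its period: the support lies
-- in a quadrant that the drift maps into itself, and after m laps the configuration agrees with the
-- initial one translated by m drifts on the translated quadrant, which the ant never leaves again.
-- Equal highways have traces that agree after shifting both, so the harmonic trace would eventually be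
-- (16k+2)-periodic; but it reads 2k at time 8k+6 and 2 at time 24k+8.

module Submission where

open import Defs
open import Data.Nat using (ℕ; _<_; _+_; _*_)
open import Data.Integer using (∣_∣)
open import Data.Product using (Σ-syntax; _×_; proj₁; proj₂)
open import Relation.Nullary using (¬_)
open import Relation.Binary.PropositionalEquality using (_≡_)

open import Data.Nat using (zero; suc; _≤_; _∸_; z≤n; s≤s; z<s; NonZero)
import Data.Nat.Properties as ℕ
open import Data.Nat.DivMod
  using (_%_; _/_; %-distribˡ-+; m%n%n≡m%n; m%n<n; m≡m%n+[m/n]*n; [m+kn]%n≡m%n; m≤n⇒m%n≡m)
open import Data.Nat.Tactic.RingSolver using (solve-∀)
open import Data.Integer as ℤ using (ℤ; 0ℤ; 1ℤ; -1ℤ)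
import Data.Integer.Properties as ℤₚ
open import Data.Fin as Fin using (Fin; toℕ)
import Data.Fin.Properties as Finₚ
open import Data.Product using (∃-syntax; _,_)
open import Data.Bool using (true; false; if_then_else_)
open import Data.Unit using (⊤; tt)
open import Data.List using (List; []; _∷_)
open import Data.List.Membership.Propositional using (_∈_; _∉_)
open import Data.List.Membership.DecPropositional _≟ₚ_ using (_∈?_)
open import Data.List.Relation.Unary.Any using (here; there)
open import Data.List.Relation.Unary.All as All using (All; []; _∷_; all?)
open import Data.List.Relation.Unary.All.Properties using (All¬⇒¬Any)
open import Data.List.Relation.Unary.AllPairs using (_∷_)
open import Data.List.Relation.Unary.Unique.DecPropositional _≟ₚ_ using (Unique; unique?)
open import Data.List.Relation.Binary.Subset.Propositional using (_⊆_)
open import Data.List.Relation.Binary.Subset.DecPropositional _≟ₚ_ using (_⊆?_)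
open import Function using (_∘_)
open import Relation.Nullary using (Dec; yes; no; does; contradiction; _×-dec_)
open import Relation.Nullary.Decidable using (dec-true; dec-false; True; toWitness; _→-dec_)
open import Relation.Binary.PropositionalEquality
  using (refl; sym; trans; cong; cong₂; subst; _≢_; module ≡-Reasoning)
open import Algebra.Bundles using (AbelianGroup)
open import Algebra.Properties.Group (AbelianGroup.group ℤₚ.+-0-abelianGroup)
  using (//-rightDividesˡ; //-rightDividesʳ)
open import Algebra.Properties.CommutativeSemigroup ℤₚ.+-commutativeSemigroup
  using () renaming (xy∙z≈xz∙y to [i+j]+k≡[i+k]+j)
open import Algebra.Properties.CommutativeSemigroup ℕ.+-commutativeSemigroup
  using () renaming (xy∙z≈xz∙y to [m+n]+o≡[m+o]+n)

iter-+ : ∀ {X : Set} m n (f : X → X) x → iter (m + n) f x ≡ iter m f (iter n f x)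
iter-+ zero    n f x = refl
iter-+ (suc m) n f x = cong f (iter-+ m n f x)

iter-commute : ∀ {X : Set} m (f : X → X) x → iter m f (f x) ≡ f (iter m f x)
iter-commute zero    f x = refl
iter-commute (suc m) f x = cong f (iter-commute m f x)

_-ₚ_ : Pos → Pos → Pos
(x , y) -ₚ (a , b) = (x ℤ.- a , y ℤ.- b)

-ₚ-+ₚ : ∀ p v → (p -ₚ v) +ₚ v ≡ p
-ₚ-+ₚ (x , y) (a , b) = cong₂ _,_ (//-rightDividesˡ a x) (//-rightDividesˡ b y)

+ₚ--ₚ : ∀ p v → (p +ₚ v) -ₚ v ≡ p
+ₚ--ₚ (x , y) (a , b) = cong₂ _,_ (//-rightDividesʳ a x) (//-rightDividesʳ b y)

+ₚ-swap : ∀ p u v → (p +ₚ u) +ₚ v ≡ (p +ₚ v) +ₚ u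
+ₚ-swap (x , y) (a , b) (c , d) = cong₂ _,_ ([i+j]+k≡[i+k]+j x a c) ([i+j]+k≡[i+k]+j y b d)

Periodic : {X : Set} → (ℕ → X) → ℕ → Set
Periodic f N = ∀ t → f (t + N) ≡ f t

module _ {X : Set} {f : ℕ → X} where

  periodic-multiple : ∀ {N} → Periodic f N → ∀ m t → f (t + m * N) ≡ f t
  periodic-multiple     per zero    t = cong f (ℕ.+-identityʳ t)
  periodic-multiple {N} per (suc m) t = begin
    f (t + (N + m * N)) ≡⟨ cong (λ u → f (t + u)) (ℕ.+-comm N (m * N)) ⟩
    f (t + (m * N + N)) ≡⟨ cong f (ℕ.+-assoc t (m * N) N) ⟨
    f (t + m * N + N)   ≡⟨ per (t + m * N) ⟩
    f (t + m * N)       ≡⟨ periodic-multiple per m t ⟩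
    f t                 ∎
    where open ≡-Reasoning

  periodic-from-residues : ∀ N → (∀ m t → t < N → f (t + m * N) ≡ f t) → Periodic f N
  periodic-from-residues zero        _        t = cong f (ℕ.+-identityʳ t)
  periodic-from-residues N@(suc _) residues t = begin
    f (t + N)                   ≡⟨ cong (λ u → f (u + N)) (m≡m%n+[m/n]*n t N) ⟩
    f (t % N + t / N * N + N)   ≡⟨ cong f ([m+n]+o≡[m+o]+n (t % N) (t / N * N) N) ⟩
    f (t % N + N + t / N * N)   ≡⟨ cong f (ℕ.+-assoc (t % N) N (t / N * N)) ⟩
    f (t % N + suc (t / N) * N) ≡⟨ residues (suc (t / N)) (t % N) (m%n<n t N) ⟩
    f (t % N)                   ≡⟨ residues (t / N) (t % N) (m%n<n t N) ⟨
    f (t % N + t / N * N)       ≡⟨ cong f (m≡m%n+[m/n]*n t N) ⟨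
    f t                         ∎
    where open ≡-Reasoning

periodic-beyond-offset : ∀ {X : Set} (σ τ : ℕ → X) {s₁ s₂ N} →
                         (∀ t → σ (s₁ + t) ≡ τ (s₂ + t)) → Periodic σ N →
                         ∀ u → s₂ ≤ u → τ (u + N) ≡ τ u
periodic-beyond-offset σ τ {s₁} {s₂} {N} σ≡τ per u s₂≤u = begin
  τ (u + N)               ≡⟨ cong (λ x → τ (x + N)) s₂+t≡u ⟨
  τ (s₂ + t + N)          ≡⟨ cong τ (ℕ.+-assoc s₂ t N) ⟩
  τ (s₂ + (t + N))        ≡⟨ σ≡τ (t + N) ⟨
  σ (s₁ + (t + N))        ≡⟨ cong σ (ℕ.+-assoc s₁ t N) ⟨
  σ (s₁ + t + N)          ≡⟨ per (s₁ + t) ⟩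
  σ (s₁ + t)              ≡⟨ σ≡τ t ⟩
  τ (s₂ + t)              ≡⟨ cong τ s₂+t≡u ⟩
  τ u                     ∎
  where
  open ≡-Reasoning
  t : ℕ
  t = u ∸ s₂
  s₂+t≡u : s₂ + t ≡ u
  s₂+t≡u = ℕ.m+[n∸m]≡n s₂≤u

Quadrant : Pos → Pos → Set
Quadrant (a , b) (x , y) = a ℤ.≤ x × b ℤ.≤ y

quadrant? : ∀ c p → Dec (Quadrant c p)
quadrant? (a , b) (x , y) = a ℤ.≤? x ×-dec b ℤ.≤? y

quadrant-translate : ∀ c {v} → Quadrant (0ℤ , 0ℤ) v → ∀ {y} → Quadrant c (y -ₚ v) → Quadrant c y
quadrant-translate (a , b) {v₁ , v₂} (0≤v₁ , 0≤v₂) {y₁ , y₂} (a≤ , b≤) =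
  ℤₚ.≤-trans a≤ (ℤₚ.i-j≤i y₁ v₁ {{ℤ.nonNegative 0≤v₁}}) ,
  ℤₚ.≤-trans b≤ (ℤₚ.i-j≤i y₂ v₂ {{ℤ.nonNegative 0≤v₂}})

Counts : Set
Counts = Pos → ℕ

tabulated : List (Pos × ℕ) → Counts
tabulated []              y = 0
tabulated ((p , c) ∷ pcs) y = if does (y ≟ₚ p) then c else tabulated pcs y

leftWalk : Pos → Dir → ℕ → List Pos
leftWalk p d zero    = []
leftWalk p d (suc r) = p ∷ leftWalk (p +ₚ unit (ccw d)) (ccw d) r

leftWalkEnd : Pos → Dir → ℕ → Pos
leftWalkEnd p d zero    = p
leftWalkEnd p d (suc r) = leftWalkEnd (p +ₚ unit (ccw d)) (ccw d) r

square : Pos → Dir → List Pos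
square p d = leftWalk p d 4

ccw⁴ : ∀ d → iter 4 ccw d ≡ d
ccw⁴ right = refl
ccw⁴ up    = refl
ccw⁴ left  = refl
ccw⁴ down  = refl

module Ant (n : ℕ) (w : Fin (suc n) → Turn) where

  Symbol : Set
  Symbol = Fin (suc n)

  Cfg : Set
  Cfg = Config n w

  position : Cfg → Pos
  position = posOf n w

  reading : Cfg → Symbol
  reading c = picOf n w c (position c)

  -- Locality and translation invariance

  AgreeOn : (Pos → Set) → Cfg → Cfg → Set
  AgreeOn Ω (C , p , d) (C′ , p′ , d′) = (∀ y → Ω y → C y ≡ C′ y) × p ≡ p′ × d ≡ d′

  _≈_ : Cfg → Cfg → Set
  _≈_ = AgreeOn (λ _ → ⊤)

  module _ {Ω : Pos → Set} where

    agreeOn-refl : ∀ {c} → AgreeOn Ω c c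
    agreeOn-refl = (λ _ _ → refl) , refl , refl

    agreeOn-trans : ∀ {c c′ c″} → AgreeOn Ω c c′ → AgreeOn Ω c′ c″ → AgreeOn Ω c c″
    agreeOn-trans (f , p , d) (g , q , e) = (λ y r → trans (f y r) (g y r)) , trans p q , trans d e

    agreeOn-weaken : ∀ {Ω′ c c′} → (∀ {y} → Ω′ y → Ω y) → AgreeOn Ω c c′ → AgreeOn Ω′ c c′
    agreeOn-weaken Ω′⊆Ω (f , p , d) = (λ y r → f y (Ω′⊆Ω r)) , p , d

    agreeOn-sym : ∀ {c c′} → AgreeOn Ω c c′ → AgreeOn Ω c′ c
    agreeOn-sym (f , p , d) = (λ y r → sym (f y r)) , sym p , sym d

    ≈⇒agreeOn : ∀ {c c′} → c ≈ c′ → AgreeOn Ω c c′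
    ≈⇒agreeOn (f , p , d) = (λ y _ → f y tt) , p , d

    reading-agreeOn : ∀ {c c′} → AgreeOn Ω c c′ → Ω (position c) → reading c ≡ reading c′
    reading-agreeOn {_ , p , _} (f , refl , _) Ωp = f p Ωp

    step-agreeOn : ∀ {c c′} → AgreeOn Ω c c′ → Ω (position c) →
                   AgreeOn Ω (step n w c) (step n w c′)
    step-agreeOn {C , p , d} {C′ , .p , .d} (C≗C′ , refl , refl) Ωp
      rewrite C≗C′ p Ωp = updated , refl , refl
      where
      updated : ∀ y → Ω y → update n w C p (incr n w (C′ p)) y
                           ≡ update n w C′ p (incr n w (C′ p)) y
      updated y Ωy with does (y ≟ₚ p)
      ... | true  = refl
      ... | false = C≗C′ y Ωy

    run-agreeOn : ∀ t {c c′} → AgreeOn Ω c c′ → (∀ s → s < t → Ω (position (run n w s c))) →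
                  AgreeOn Ω (run n w t c) (run n w t c′)
    run-agreeOn zero    c≈c′ inΩ = c≈c′
    run-agreeOn (suc t) c≈c′ inΩ =
      step-agreeOn (run-agreeOn t c≈c′ (λ s s<t → inΩ s (ℕ.m<n⇒m<1+n s<t))) (inΩ t ℕ.≤-refl)

  run-≈ : ∀ t {c c′} → c ≈ c′ → run n w t c ≈ run n w t c′
  run-≈ t c≈c′ = run-agreeOn t c≈c′ (λ _ _ → tt)

  untouched : ∀ t c y → (∀ s → s < t → position (run n w s c) ≢ y) →
              picOf n w (run n w t c) y ≡ picOf n w c y
  untouched zero    c y unvisited = refl
  untouched (suc t) c y unvisited = begin
    update n w C p _ y ≡⟨ cong (if_then _ else C y) (dec-false (y ≟ₚ p) (unvisited t ℕ.≤-refl ∘ sym)) ⟩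
    C y                ≡⟨ untouched t c y (λ s s<t → unvisited s (ℕ.m<n⇒m<1+n s<t)) ⟩
    picOf n w c y      ∎
    where
    open ≡-Reasoning
    C : Pos → Symbol
    C = picOf n w (run n w t c)
    p : Pos
    p = position (run n w t c)

  ≈-trans : ∀ {c c′ c″} → c ≈ c′ → c′ ≈ c″ → c ≈ c″
  ≈-trans = agreeOn-trans

  translate : Pos → Cfg → Cfg
  translate v (C , p , d) = (λ y → C (y -ₚ v)) , p +ₚ v , d

  translate-agreeOn : ∀ {Ω} v {c c′} → AgreeOn Ω c c′ →
                      AgreeOn (λ y → Ω (y -ₚ v)) (translate v c) (translate v c′)
  translate-agreeOn v (f , p , d) = (λ y → f (y -ₚ v)) , cong (_+ₚ v) p , d

  step-translate : ∀ v c → step n w (translate v c) ≈ translate v (step n w c)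
  step-translate v (C , p , d) rewrite +ₚ--ₚ p v = written , +ₚ-swap p v _ , refl
    where
    sameCell : ∀ y → does (y ≟ₚ (p +ₚ v)) ≡ does ((y -ₚ v) ≟ₚ p)
    sameCell y with y ≟ₚ (p +ₚ v) | (y -ₚ v) ≟ₚ p
    ... | yes _   | yes _   = refl
    ... | no _    | no _    = refl
    ... | yes y≡p | no y≢p  = contradiction (trans (cong (_-ₚ v) y≡p) (+ₚ--ₚ p v)) y≢p
    ... | no y≢p  | yes y≡p = contradiction (trans (sym (-ₚ-+ₚ y v)) (cong (_+ₚ v) y≡p)) y≢p

    written : ∀ y → ⊤ → update n w (λ y → C (y -ₚ v)) (p +ₚ v) (incr n w (C p)) y
                       ≡ update n w C p (incr n w (C p)) (y -ₚ v)
    written y _ = cong (if_then incr n w (C p) else C (y -ₚ v)) (sameCell y)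

  run-translate : ∀ t v c → run n w t (translate v c) ≈ translate v (run n w t c)
  run-translate zero    v c = agreeOn-refl
  run-translate (suc t) v c =
    ≈-trans (step-agreeOn (run-translate t v c) tt) (step-translate v (run n w t c))

  translate^ : ℕ → Pos → Cfg → Cfg
  translate^ m v = iter m (translate v)

  run-translate^ : ∀ t m v c → run n w t (translate^ m v c) ≈ translate^ m v (run n w t c)
  run-translate^ t zero    v c = agreeOn-refl
  run-translate^ t (suc m) v c =
    ≈-trans (run-translate t v (translate^ m v c)) (translate-agreeOn v (run-translate^ t m v c))

  translate^-agreeOn : ∀ {Ω} m v {c c′} → AgreeOn Ω c c′ →
                       AgreeOn (λ y → Ω (iter m (_-ₚ v) y)) (translate^ m v c) (translate^ m v c′)
  translate^-agreeOn zero    v c≈c′ = c≈c′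
  translate^-agreeOn {Ω} (suc m) v c≈c′ =
    agreeOn-weaken (λ {y} → subst Ω (sym (iter-commute m (_-ₚ v) y)))
                   (translate-agreeOn v (translate^-agreeOn m v c≈c′))

  reading-translate^ : ∀ m v c → reading (translate^ m v c) ≡ reading c
  reading-translate^ zero    v c = refl
  reading-translate^ (suc m) v c = trans (cong C (+ₚ--ₚ p v)) (reading-translate^ m v c)
    where
    C : Pos → Symbol
    C = picOf n w (translate^ m v c)
    p : Pos
    p = position (translate^ m v c)

  position-translate^ : ∀ m v c → position (translate^ m v c) ≡ iter m (_+ₚ v) (position c)
  position-translate^ zero    v c = refl
  position-translate^ (suc m) v c = cong (_+ₚ v) (position-translate^ m v c)

  iter--ₚ-+ₚ : ∀ m v p → iter m (_-ₚ v) (iter m (_+ₚ v) p) ≡ p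
  iter--ₚ-+ₚ zero    v p = refl
  iter--ₚ-+ₚ (suc m) v p = begin
    iter (suc m) (_-ₚ v) (iter m (_+ₚ v) p +ₚ v)  ≡⟨ iter-commute m (_-ₚ v) _ ⟨
    iter m (_-ₚ v) ((iter m (_+ₚ v) p +ₚ v) -ₚ v) ≡⟨ cong (iter m (_-ₚ v)) (+ₚ--ₚ _ v) ⟩
    iter m (_-ₚ v) (iter m (_+ₚ v) p)             ≡⟨ iter--ₚ-+ₚ m v p ⟩
    p                                             ∎
    where open ≡-Reasoning

  run-+ : ∀ a b c → run n w (a + b) c ≡ run n w b (run n w a c)
  run-+ a b c = trans (cong (λ t → run n w t c) (ℕ.+-comm a b)) (iter-+ b a (step n w) c)

  -- Configurations given by visit counts

  ⟨_⟩ : ℕ → Symbol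
  ⟨ c ⟩ = iter c (incr n w) Fin.zero

  toℕ-⟨⟩ : ∀ c → toℕ ⟨ c ⟩ ≡ c % suc n
  toℕ-⟨⟩ zero    = refl
  toℕ-⟨⟩ (suc c) = begin
    toℕ (incr n w ⟨ c ⟩)               ≡⟨ Finₚ.toℕ-fromℕ< _ ⟩
    suc (toℕ ⟨ c ⟩) % suc n            ≡⟨ cong (λ r → suc r % suc n) (toℕ-⟨⟩ c) ⟩
    (1 + c % suc n) % suc n            ≡⟨ %-distribˡ-+ 1 (c % suc n) (suc n) ⟩
    (1 % suc n + c % suc n % suc n) % suc n
                                       ≡⟨ cong (λ r → (1 % suc n + r) % suc n) (m%n%n≡m%n c (suc n)) ⟩
    (1 % suc n + c % suc n) % suc n    ≡⟨ %-distribˡ-+ 1 c (suc n) ⟨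
    suc c % suc n                      ∎
    where open ≡-Reasoning

  infix 4 _≋_
  _≋_ : ℕ → ℕ → Set
  c ≋ v = ∃[ q ] c ≡ q * suc n + v

  ≋-refl : ∀ {c} → c ≋ c
  ≋-refl = 0 , refl

  ≡⇒≋ : ∀ {c v} → c ≡ v → c ≋ v
  ≡⇒≋ c≡v = 0 , c≡v

  ≋-≡ : ∀ {c v v′} → c ≋ v → v ≡ v′ → c ≋ v′
  ≋-≡ c≋v refl = c≋v

  ≋-+ʳ : ∀ {c v} m → c ≋ v → c + m ≋ v + m
  ≋-+ʳ {v = v} m (q , refl) = q , ℕ.+-assoc (q * suc n) v m

  ≋-wrap : ∀ {c} → c ≋ n → c + 1 ≋ 0
  ≋-wrap (q , refl) = suc q , (begin
    q * suc n + n + 1       ≡⟨ ℕ.+-assoc (q * suc n) n 1 ⟩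
    q * suc n + (n + 1)     ≡⟨ cong (λ m → q * suc n + m) (ℕ.+-comm n 1) ⟩
    q * suc n + suc n       ≡⟨ ℕ.+-comm (q * suc n) (suc n) ⟩
    suc q * suc n           ≡⟨ ℕ.+-identityʳ (suc q * suc n) ⟨
    suc q * suc n + 0       ∎)
    where open ≡-Reasoning

  ≋⇒% : ∀ {c v} → c ≋ v → c % suc n ≡ v % suc n
  ≋⇒% {v = v} (q , refl) = trans (cong (_% suc n) (ℕ.+-comm (q * suc n) v)) ([m+kn]%n≡m%n v q (suc n))

  ⟨⟩-≋ : ∀ {c v} → c ≋ v → ⟨ c ⟩ ≡ ⟨ v ⟩
  ⟨⟩-≋ {c} {v} c≋v = Finₚ.toℕ-injective (trans (toℕ-⟨⟩ c) (trans (≋⇒% c≋v) (sym (toℕ-⟨⟩ v))))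

  toℕ-⟨⟩-≋ : ∀ {c v} → c ≋ v → v ≤ n → toℕ ⟨ c ⟩ ≡ v
  toℕ-⟨⟩-≋ {c} {v} c≋v v≤n = trans (toℕ-⟨⟩ c) (trans (≋⇒% c≋v) (m≤n⇒m%n≡m v≤n))

  State : Set
  State = Counts × Pos × Dir

  ⟦_⟧ : State → Cfg
  ⟦ κ , p , d ⟧ = (λ y → ⟨ κ y ⟩) , p , d

  addOn : List Pos → ℕ → Counts → Counts
  addOn qs a κ y = if does (y ∈? qs) then κ y + a else κ y

  visit : Pos → Counts → Counts
  visit p = addOn (p ∷ []) 1

  addOn-∈ : ∀ {qs y} a κ → y ∈ qs → addOn qs a κ y ≡ κ y + a
  addOn-∈ {qs} {y} a κ y∈qs rewrite dec-true (y ∈? qs) y∈qs = refl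

  addOn-∉ : ∀ {qs y} a κ → y ∉ qs → addOn qs a κ y ≡ κ y
  addOn-∉ {qs} {y} a κ y∉qs rewrite dec-false (y ∈? qs) y∉qs = refl

  addOn-addOn : ∀ qs a b κ y → addOn qs a (addOn qs b κ) y ≡ addOn qs (b + a) κ y
  addOn-addOn qs a b κ y with does (y ∈? qs)
  ... | true  = ℕ.+-assoc (κ y) b a
  ... | false = refl

  addOn-zero : ∀ qs κ y → addOn qs 0 κ y ≡ κ y
  addOn-zero qs κ y with does (y ∈? qs)
  ... | true  = ℕ.+-identityʳ (κ y)
  ... | false = refl

  addOn-∷ : ∀ {q qs} a κ → q ∉ qs → ∀ y → addOn qs a (addOn (q ∷ []) a κ) y ≡ addOn (q ∷ qs) a κ y
  addOn-∷ {q} {qs} a κ q∉qs y with y ≟ₚ q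
  ... | yes refl rewrite dec-false (y ∈? qs) q∉qs = refl
  ... | no  _    = refl

  step-⟦⟧ : ∀ {κ p d x} → w ⟨ κ p ⟩ ≡ x →
            step n w ⟦ κ , p , d ⟧ ≈ ⟦ visit p κ , p +ₚ unit (turn x d) , turn x d ⟧
  step-⟦⟧ {κ} {p} refl = written , refl , refl
    where
    written : ∀ y → ⊤ → update n w (λ y → ⟨ κ y ⟩) p (incr n w ⟨ κ p ⟩) y ≡ ⟨ visit p κ y ⟩
    written y _ with y ≟ₚ p
    ... | yes refl = cong ⟨_⟩ (sym (ℕ.+-comm (κ y) 1))
    ... | no  _    = refl

  module Within (S : List Pos) where

    infix  4 _⟶[_]_
    infixl 5 _▸_

    record _⟶[_]_ (σ : State) (t : ℕ) (σ′ : State) : Set where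
      constructor segment
      field
        arrives : run n w t ⟦ σ ⟧ ≈ ⟦ σ′ ⟧
        stays   : ∀ s → s < t → position (run n w s ⟦ σ ⟧) ∈ S
    open _⟶[_]_ public

    _▸_ : ∀ {σ σ′ σ″ a b} → σ ⟶[ a ] σ′ → σ′ ⟶[ b ] σ″ → σ ⟶[ a + b ] σ″
    _▸_ {σ} {_} {σ″} {a} {b} (segment arrives₁ stays₁) (segment arrives₂ stays₂) =
      segment (subst (_≈ ⟦ σ″ ⟧) (sym (run-+ a b c)) (≈-trans (run-≈ b arrives₁) arrives₂)) stays′
      where
      c : Cfg
      c = ⟦ σ ⟧
      stays′ : ∀ s → s < a + b → position (run n w s c) ∈ S
      stays′ s s<a+b with s ℕ.<? a
      ... | yes s<a = stays₁ s s<a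
      ... | no  s≮a = subst (λ t → position (run n w t c) ∈ S) a+[s∸a]≡s (later (s ∸ a) s∸a<b)
        where
        a+[s∸a]≡s : a + (s ∸ a) ≡ s
        a+[s∸a]≡s = ℕ.m+[n∸m]≡n (ℕ.≮⇒≥ s≮a)
        s∸a<b : s ∸ a < b
        s∸a<b = ℕ.+-cancelˡ-< a (s ∸ a) b (subst (_< a + b) (sym a+[s∸a]≡s) s<a+b)
        later : ∀ d → d < b → position (run n w (a + d) c) ∈ S
        later d d<b =
          subst (_∈ S) (sym (trans (cong position (run-+ a d c)) (proj₁ (proj₂ (run-≈ d arrives₁)))))
                (stays₂ d d<b)

    retime : ∀ {σ σ′ t t′} → t ≡ t′ → σ ⟶[ t ] σ′ → σ ⟶[ t′ ] σ′
    retime refl seg = seg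

    ≈-target : ∀ {σ σ′ σ″ t} → σ ⟶[ t ] σ′ → ⟦ σ′ ⟧ ≈ ⟦ σ″ ⟧ → σ ⟶[ t ] σ″
    ≈-target (segment arrives₁ stays₁) σ′≈σ″ = segment (≈-trans arrives₁ σ′≈σ″) stays₁

    single : ∀ {σ σ′} → step n w ⟦ σ ⟧ ≈ ⟦ σ′ ⟧ → position ⟦ σ ⟧ ∈ S → σ ⟶[ 1 ] σ′
    single σ′≈ p∈S = segment σ′≈ λ { zero _ → p∈S ; (suc _) (s≤s ()) }

    stay : ∀ {σ σ′} → ⟦ σ ⟧ ≈ ⟦ σ′ ⟧ → σ ⟶[ 0 ] σ′
    stay σ≈σ′ = segment σ≈σ′ λ _ ()

    reading-after : ∀ {σ σ′ t} → σ ⟶[ t ] σ′ → reading (run n w t ⟦ σ ⟧) ≡ reading ⟦ σ′ ⟧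
    reading-after seg = reading-agreeOn (arrives seg) tt

    turnLeft : ∀ {κ p d} → w ⟨ κ p ⟩ ≡ L → p ∈ S →
               (κ , p , d) ⟶[ 1 ] (visit p κ , p +ₚ unit (ccw d) , ccw d)
    turnLeft reads-L = single (step-⟦⟧ reads-L)

    turnRight : ∀ {κ p d} → w ⟨ κ p ⟩ ≡ R → p ∈ S →
                (κ , p , d) ⟶[ 1 ] (visit p κ , p +ₚ unit (cw d) , cw d)
    turnRight reads-R = single (step-⟦⟧ reads-R)

    walkLeft : ∀ r {p d κ} → Unique (leftWalk p d r) → leftWalk p d r ⊆ S →
               All (λ y → w ⟨ κ y ⟩ ≡ L) (leftWalk p d r) →
               (κ , p , d) ⟶[ r ] (addOn (leftWalk p d r) 1 κ , leftWalkEnd p d r , iter r ccw d)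
    walkLeft zero    _ _ _ = stay agreeOn-refl
    walkLeft (suc r) {p} {d} {κ} (p≢rest ∷ unique) ⊆S (reads-L ∷ rest-reads-L) =
      ≈-target (turnLeft reads-L (⊆S (here refl))
                ▸ walkLeft r unique (⊆S ∘ there) (All.zipWith unvisited (p≢rest , rest-reads-L)))
               ((λ y _ → cong ⟨_⟩ (addOn-∷ 1 κ (All¬⇒¬Any p≢rest) y)) , refl , iter-commute r ccw d)
      where
      unvisited : ∀ {y} → p ≢ y × w ⟨ κ y ⟩ ≡ L → w ⟨ visit p κ y ⟩ ≡ L
      unvisited {y} (p≢y , reads-L) =
        subst (λ c → w ⟨ c ⟩ ≡ L) (sym (addOn-∉ {p ∷ []} 1 κ λ { (here y≡p) → p≢y (sym y≡p) })) reads-L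

    circle : ∀ m {p d κ} → Unique (square p d) → leftWalkEnd p d 4 ≡ p → square p d ⊆ S →
             All (λ y → ∀ i → i < m → w ⟨ κ y + i ⟩ ≡ L) (square p d) →
             (κ , p , d) ⟶[ m * 4 ] (addOn (square p d) m κ , p , d)
    circle zero {p} {d} {κ} _ _ _ _ =
      stay ((λ y _ → cong ⟨_⟩ (sym (addOn-zero (square p d) κ y))) , refl , refl)
    circle (suc m) {p} {d} {κ} unique closes ⊆S reads-L =
      retime (ℕ.+-comm (m * 4) 4)
        (≈-target (circle m unique closes ⊆S (All.map (λ r i i<m → r i (ℕ.m<n⇒m<1+n i<m)) reads-L)
                   ▸ walkLeft 4 unique ⊆S (All.tabulate lastRound))
                  ((λ y _ → cong ⟨_⟩ (one-more y)) , closes , ccw⁴ d))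
      where
      one-more : ∀ y → addOn (square p d) 1 (addOn (square p d) m κ) y ≡ addOn (square p d) (suc m) κ y
      one-more y =
        trans (addOn-addOn (square p d) 1 m κ y) (cong (λ a → addOn (square p d) a κ y) (ℕ.+-comm m 1))
      lastRound : ∀ {y} → y ∈ square p d → w ⟨ addOn (square p d) m κ y ⟩ ≡ L
      lastRound y∈ = subst (λ c → w ⟨ c ⟩ ≡ L) (sym (addOn-∈ m κ y∈)) (All.lookup reads-L y∈ m (ℕ.n<1+n m))

    RepeatsAt : Counts → Counts → (v x : Pos) → Dec ((x +ₚ v) ∈ S) → Set
    RepeatsAt κ₀ κ₁ v x (yes _) = ⟨ κ₀ x ⟩ ≡ ⟨ κ₁ (x +ₚ v) ⟩
    RepeatsAt κ₀ κ₁ v x (no  _) = ⟨ κ₀ x ⟩ ≡ Fin.zero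

    Repeats : Counts → Counts → Pos → Set
    Repeats κ₀ κ₁ v = All (λ x → RepeatsAt κ₀ κ₁ v x ((x +ₚ v) ∈? S)) S

    highway : ∀ {κ₀ κ₁ p d N v} → (κ₀ , p , d) ⟶[ N ] (κ₁ , p +ₚ v , d) → p ∈ S →
              Repeats κ₀ κ₁ v → Highway n w
    highway {κ₀} {κ₁} {p} {d} {N} {v} seg p∈S repeats = record
      { support = S ; pat = λ y → ⟨ κ₀ y ⟩ ; start = p ; dir = d ; period = N ; drift = v
      ; startIn = p∈S ; inside = stays seg
      ; returnPos = proj₁ (proj₂ (arrives seg)) ; returnDir = proj₂ (proj₂ (arrives seg))
      ; shift = λ x x∈S → repeated x ((x +ₚ v) ∈? S) (All.lookup repeats x∈S) }
      where
      repeated : ∀ x (x+v∈?S : Dec ((x +ₚ v) ∈ S)) → RepeatsAt κ₀ κ₁ v x x+v∈?S →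
                 ((x +ₚ v) ∈ S → ⟨ κ₀ x ⟩ ≡ picOf n w (run n w N ⟦ κ₀ , p , d ⟧) (x +ₚ v)) ×
                 (¬ (x +ₚ v) ∈ S → ⟨ κ₀ x ⟩ ≡ Fin.zero)
      repeated x (yes x+v∈S) κ₀≡κ₁ =
        (λ _ → trans κ₀≡κ₁ (sym (proj₁ (arrives seg) (x +ₚ v) tt))) , contradiction x+v∈S
      repeated x (no  x+v∉S) κ₀≡0  = (λ x+v∈S → contradiction x+v∈S x+v∉S) , λ _ → κ₀≡0

  -- Traces of highways

  trace : Highway n w → ℕ → Symbol
  trace H t = reading (run n w t (extend n w H , start H , dir H))

  module _ (H : Highway n w) where

    private
      S : List Pos
      S = support H
      c₀ cₚ : Cfg
      c₀ = extend n w H , start H , dir H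
      cₚ = pat H , start H , dir H

    extend-on : ∀ {y} → y ∈ S → extend n w H y ≡ pat H y
    extend-on {y} y∈S rewrite dec-true (y ∈? S) y∈S = refl

    extend-off : ∀ {y} → y ∉ S → extend n w H y ≡ Fin.zero
    extend-off {y} y∉S rewrite dec-false (y ∈? S) y∉S = refl

    first-lap : ∀ t → t ≤ period H → AgreeOn (_∈ S) (run n w t cₚ) (run n w t c₀)
    first-lap t t≤N = run-agreeOn t ((λ y y∈S → sym (extend-on y∈S)) , refl , refl)
                                    (λ s s<t → inside H s (ℕ.<-≤-trans s<t t≤N))

    trace-before-period : ∀ t → t < period H → trace H t ≡ reading (run n w t cₚ)
    trace-before-period t t<N = sym (reading-agreeOn (first-lap t (ℕ.<⇒≤ t<N)) (inside H t t<N))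

  -- Support cells that are not translates of support cells may hold arbitrary symbols after a lap;
  -- `covered` keeps them outside the translate of G, where all later laps take place.
  module HighwayPeriodicity
    (H : Highway n w) (G : Pos → Set)
    (support⊆G : ∀ {y} → y ∈ support H → G y)
    (G-drift   : ∀ {y} → G (y -ₚ drift H) → G y)
    (covered   : ∀ {y} → y ∈ support H → G (y -ₚ drift H) → (y -ₚ drift H) ∈ support H)
    where

    private
      S : List Pos
      S = support H
      N : ℕ
      N = period H
      v : Pos
      v = drift H
      c₀ cₚ : Cfg
      c₀ = extend n w H , start H , dir H
      cₚ = pat H , start H , dir H

    visits-support : ∀ s → s < N → position (run n w s c₀) ∈ S
    visits-support s s<N = subst (_∈ S) (proj₁ (proj₂ (first-lap H s (ℕ.<⇒≤ s<N)))) (inside H s s<N)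

    blank-after : ∀ {y} → y ∉ S → picOf n w (run n w N c₀) y ≡ Fin.zero
    blank-after {y} y∉S =
      trans (untouched N c₀ y (λ s s<N s↦y → y∉S (subst (_∈ S) s↦y (visits-support s s<N))))
            (extend-off H y∉S)

    after-lap : ∀ y → G (y -ₚ v) → picOf n w (run n w N c₀) y ≡ extend n w H (y -ₚ v)
    after-lap y G[y-v] with (y -ₚ v) ∈? S | y ∈? S
    ... | yes y-v∈S | yes y∈S = begin
      picOf n w (run n w N c₀) y   ≡⟨ proj₁ (first-lap H N ℕ.≤-refl) y y∈S ⟨
      picOf n w (run n w N cₚ) y   ≡⟨ cong (picOf n w (run n w N cₚ)) (-ₚ-+ₚ y v) ⟨
      picOf n w (run n w N cₚ) ((y -ₚ v) +ₚ v)
                                   ≡⟨ proj₁ (shift H _ y-v∈S) (subst (_∈ S) (sym (-ₚ-+ₚ y v)) y∈S) ⟨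
      pat H (y -ₚ v)               ∎
      where open ≡-Reasoning
    ... | yes y-v∈S | no y∉S =
      trans (blank-after y∉S) (sym (proj₂ (shift H _ y-v∈S) (y∉S ∘ subst (_∈ S) (-ₚ-+ₚ y v))))
    ... | no y-v∉S | yes y∈S = contradiction (covered y∈S G[y-v]) y-v∉S
    ... | no y-v∉S | no y∉S  = blank-after y∉S

    one-lap : AgreeOn (λ y → G (y -ₚ v)) (run n w N c₀) (translate v c₀)
    one-lap = after-lap , trans (sym (proj₁ (proj₂ (first-lap H N ℕ.≤-refl)))) (returnPos H)
                    , trans (sym (proj₂ (proj₂ (first-lap H N ℕ.≤-refl)))) (returnDir H)

    Shifted : ℕ → Pos → Set
    Shifted m y = G (iter m (_-ₚ v) y)

    stays-shifted : ∀ m s → s < N → Shifted m (position (run n w s (translate^ m v c₀)))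
    stays-shifted m s s<N =
      subst (Shifted m) (sym (trans (proj₁ (proj₂ (run-translate^ s m v c₀))) (position-translate^ m v _)))
            (subst G (sym (iter--ₚ-+ₚ m v _)) (support⊆G (visits-support s s<N)))

    laps : ∀ m → AgreeOn (Shifted m) (run n w (m * N) c₀) (translate^ m v c₀)
    laps zero    = agreeOn-refl
    laps (suc m) =
      subst (λ c → AgreeOn (Shifted (suc m)) c (translate^ (suc m) v c₀))
            (sym (iter-+ N (m * N) (step n w) c₀))
        (agreeOn-trans
          (agreeOn-weaken G-drift (agreeOn-sym (run-agreeOn N (agreeOn-sym (laps m)) (stays-shifted m))))
        (agreeOn-trans (≈⇒agreeOn (run-translate^ N m v c₀))
        (subst (AgreeOn (Shifted (suc m)) (translate^ m v (run n w N c₀))) (iter-commute m (translate v) c₀)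
               (translate^-agreeOn m v one-lap))))

    residues : ∀ m t → t < N → trace H (t + m * N) ≡ trace H t
    residues m t t<N = begin
      reading (run n w (t + m * N) c₀)                 ≡⟨ cong reading (iter-+ t (m * N) (step n w) c₀) ⟩
      reading (run n w t (run n w (m * N) c₀))         ≡⟨ reading-agreeOn later (stays-shifted m t t<N) ⟨
      reading (run n w t (translate^ m v c₀))          ≡⟨ reading-agreeOn (run-translate^ t m v c₀) tt ⟩
      reading (translate^ m v (run n w t c₀))          ≡⟨ reading-translate^ m v _ ⟩
      reading (run n w t c₀)                           ∎
      where
      open ≡-Reasoning
      later : AgreeOn (Shifted m) (run n w t (translate^ m v c₀)) (run n w t (run n w (m * N) c₀))
      later = run-agreeOn t (agreeOn-sym (laps m)) (λ s s<t → stays-shifted m s (ℕ.<-trans s<t t<N))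

    trace-periodic : Periodic (trace H) N
    trace-periodic = periodic-from-residues N residues

  quadrant-trace-periodic :
    ∀ (H : Highway n w) c
      {_ : True (quadrant? (0ℤ , 0ℤ) (drift H))}
      {_ : True (all? (quadrant? c) (support H))}
      {_ : True (all? (λ y → quadrant? c (y -ₚ drift H) →-dec (y -ₚ drift H) ∈? support H)
                      (support H))} →
    Periodic (trace H) (period H)
  quadrant-trace-periodic H c {drift≥0} {support⊆G} {covered} =
    HighwayPeriodicity.trace-periodic H (Quadrant c)
      (All.lookup (toWitness support⊆G)) (quadrant-translate c (toWitness drift≥0))
      (All.lookup (toWitness covered))

  sameHighway⇒traces : ∀ H₁ H₂ → SameHighway n w H₁ H₂ →
                       ∃[ s₁ ] ∃[ s₂ ] (∀ t → trace H₁ (s₁ + t) ≡ trace H₂ (s₂ + t))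
  sameHighway⇒traces H₁ H₂ (_ , _ , s₁ , s₂ , same) = s₁ , s₂ , λ t → cong (proj₂ ∘ proj₂) (same t)

  traces-distinguish : ∀ (H₁ H₂ : Highway n w) .{{_ : NonZero (period H₂)}} →
                       Periodic (trace H₁) (period H₁) → Periodic (trace H₂) (period H₂) →
                       ∀ i → trace H₂ (i + period H₁) ≢ trace H₂ i → ¬ SameHighway n w H₁ H₂
  traces-distinguish H₁ H₂ per₁ per₂ i differs same with sameHighway⇒traces H₁ H₂ same
  ... | s₁ , s₂ , traces≡ = differs (begin
    trace H₂ (i + N₁)               ≡⟨ periodic-multiple per₂ s₂ (i + N₁) ⟨
    trace H₂ (i + N₁ + s₂ * N₂)     ≡⟨ cong (trace H₂) ([m+n]+o≡[m+o]+n i N₁ (s₂ * N₂)) ⟩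
    trace H₂ (i + s₂ * N₂ + N₁)
      ≡⟨ periodic-beyond-offset (trace H₁) (trace H₂) {s₁} traces≡ per₁ (i + s₂ * N₂) s₂≤ ⟩
    trace H₂ (i + s₂ * N₂)          ≡⟨ periodic-multiple per₂ s₂ i ⟩
    trace H₂ i                      ∎)
    where
    open ≡-Reasoning
    N₁ N₂ : ℕ
    N₁ = period H₁
    N₂ = period H₂
    s₂≤ : s₂ ≤ i + s₂ * N₂
    s₂≤ = ℕ.≤-trans (ℕ.m≤m*n s₂ N₂) (ℕ.m≤n+m (s₂ * N₂) i)

2ℤ -2ℤ : ℤ
2ℤ  = ℤ.+ 2
-2ℤ = ℤ.-[1+ 1 ]

module L²ᵏR-Ant (k : ℕ) where

  open Ant (2 * k) (LR k)

  k+k≡2k : k + k ≡ 2 * k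
  k+k≡2k = cong (λ m → k + m) (sym (ℕ.+-identityʳ k))

  LR-max : ∀ a → toℕ a ≡ 2 * k → LR k a ≡ R
  LR-max a a≡n = cong (if_then R else L) (dec-true (toℕ a ℕ.≟ 2 * k) a≡n)

  LR-below : ∀ a → toℕ a < 2 * k → LR k a ≡ L
  LR-below a a<n = cong (if_then R else L) (dec-false (toℕ a ℕ.≟ 2 * k) (ℕ.<⇒≢ a<n))

  reads-R : ∀ {c} → c ≋ 2 * k → LR k ⟨ c ⟩ ≡ R
  reads-R c≋n = LR-max _ (toℕ-⟨⟩-≋ c≋n ℕ.≤-refl)

  reads-L : ∀ {c} v → c ≋ v → v < 2 * k → LR k ⟨ c ⟩ ≡ L
  reads-L v c≋v v<n = LR-below _ (subst (_< 2 * k) (sym (toℕ-⟨⟩-≋ c≋v (ℕ.<⇒≤ v<n))) v<n)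

  reads-L-while : ∀ {c} v m → c ≋ v → v + m ≤ 2 * k → ∀ i → i < m → LR k ⟨ c + i ⟩ ≡ L
  reads-L-while v m c≋v v+m≤n i i<m =
    reads-L (v + i) (≋-+ʳ i c≋v) (ℕ.<-≤-trans (ℕ.+-monoʳ-< v i<m) v+m≤n)

  module Moves (S : List Pos) where

    open Within S public

    turnR : ∀ {κ p d} → κ p ≋ 2 * k → {_ : True (p ∈? S)} →
            (κ , p , d) ⟶[ 1 ] (visit p κ , p +ₚ unit (cw d) , cw d)
    turnR c≋n {p∈S} = turnRight (reads-R c≋n) (toWitness p∈S)

    turnL : ∀ {κ p d} v → κ p ≋ v → v < 2 * k → {_ : True (p ∈? S)} →
            (κ , p , d) ⟶[ 1 ] (visit p κ , p +ₚ unit (ccw d) , ccw d)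
    turnL v c≋v v<n {p∈S} = turnLeft (reads-L v c≋v v<n) (toWitness p∈S)

    loop : ∀ m p d {κ} {_ : True (unique? (square p d))} {_ : True (leftWalkEnd p d 4 ≟ₚ p)}
             {_ : True (square p d ⊆? S)} →
           All (λ y → ∃[ v ] κ y ≋ v × v + m ≤ 2 * k) (square p d) →
           (κ , p , d) ⟶[ m * 4 ] (addOn (square p d) m κ , p , d)
    loop m p d {_} {unique} {closes} {⊆S} below =
      circle m (toWitness unique) (toWitness closes) (toWitness ⊆S)
             (All.map (λ (v , c≋v , v+m≤n) → reads-L-while v m c≋v v+m≤n) below)

fundamental-lap-time : ∀ j → 2 * suc j * 4 + 1 + suc j * 4 + 1 + j * 4 + 1 + 1 + 1 + 1 ≡ 16 * suc j + 2
fundamental-lap-time = solve-∀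

module Fundamental (j : ℕ) where

  k n : ℕ
  k = suc j
  n = 2 * k

  open Ant n (LR k)
  open L²ᵏR-Ant k

  k+1+j≡n : k + 1 + j ≡ n
  k+1+j≡n = trans (ℕ.+-assoc k 1 j) k+k≡2k

  j+j≤n : j + j ≤ n
  j+j≤n = subst (j + j ≤_) k+k≡2k (ℕ.+-mono-≤ (ℕ.n≤1+n j) (ℕ.n≤1+n j))

  k+j≤n : k + j ≤ n
  k+j≤n = subst (k + j ≤_) k+k≡2k (ℕ.+-monoʳ-≤ k (ℕ.n≤1+n j))

  S₁ : List Pos
  S₁ = (0ℤ , 0ℤ) ∷ (0ℤ , 1ℤ) ∷ (-1ℤ , 1ℤ) ∷ (-1ℤ , 0ℤ) ∷ (0ℤ , -1ℤ) ∷ (1ℤ , -1ℤ) ∷ (1ℤ , 0ℤ)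
     ∷ (-1ℤ , -1ℤ) ∷ (-1ℤ , -2ℤ) ∷ (0ℤ , -2ℤ) ∷ []

  κ₀ : Counts
  κ₀ = tabulated (((-1ℤ , -2ℤ) , j) ∷ ((0ℤ , -2ℤ) , k) ∷ ((-1ℤ , -1ℤ) , k + 1) ∷ ((0ℤ , -1ℤ) , k) ∷ [])

  open Moves S₁

  lap : ∃[ κ ] (κ₀ , (0ℤ , 0ℤ) , right) ⟶[ 16 * k + 2 ] (κ , (1ℤ , 1ℤ) , right)
  lap = _ , retime (fundamental-lap-time j)
    ( loop n (0ℤ , 0ℤ) right (blank ∷ blank ∷ blank ∷ blank ∷ [])
    ▸ turnR ≋-refl
    ▸ loop k (0ℤ , -1ℤ) down ( (k , ≋-refl , ℕ.≤-reflexive k+k≡2k)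
                             ∷ (0 , ≋-refl , ℕ.m≤m+n k _)
                             ∷ (0 , ≋-refl , ℕ.m≤m+n k _)
                             ∷ (0 , ≋-wrap ≋-refl , ℕ.m≤m+n k _) ∷ [])
    ▸ turnR (≡⇒≋ k+k≡2k)
    ▸ loop j (-1ℤ , -1ℤ) left ( (k + 1 , ≋-refl , ℕ.≤-reflexive k+1+j≡n)
                              ∷ (j , ≋-refl , j+j≤n)
                              ∷ (k , ≋-refl , k+j≤n)
                              ∷ (0 , ≋-wrap (≡⇒≋ k+k≡2k) , ℕ.≤-trans (ℕ.m≤n+m j j) j+j≤n) ∷ [])
    ▸ turnR (≡⇒≋ k+1+j≡n)
    ▸ turnR ≋-refl
    ▸ turnL k (≋-+ʳ k (≋-wrap ≋-refl)) (ℕ.m<m+n k z<s)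
    ▸ turnR ≋-refl)
    where
    blank : ∃[ v ] 0 ≋ v × v + n ≤ n
    blank = 0 , ≋-refl , ℕ.≤-refl

  H₁ : Highway n (LR k)
  H₁ = highway (proj₂ lap) (here refl) repeats
    where
    repeats : Repeats κ₀ (proj₁ lap) (1ℤ , 1ℤ)
    repeats = refl ∷ refl ∷ refl
            ∷ sym (⟨⟩-≋ (≋-wrap ≋-refl))
            ∷ refl ∷ refl ∷ refl
            ∷ sym (⟨⟩-≋ (≋-+ʳ 1 (≋-+ʳ k (≋-wrap ≋-refl))))
            ∷ sym (⟨⟩-≋ (≋-+ʳ j (≋-wrap (≡⇒≋ k+k≡2k))))
            ∷ refl ∷ []

  H₁-periodic : Periodic (trace H₁) (period H₁)
  H₁-periodic = quadrant-trace-periodic H₁ (-1ℤ , -2ℤ)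

harmonic-first-time : ∀ j → 2 * suc j * 4 + 1 + 1 + 1 + 1 + 1 + 1 ≡ 8 * suc j + 6
harmonic-first-time = solve-∀

harmonic-second-time : ∀ j → 1 + 1 + 1 + 1 + 2 * suc j * 4 + 1 + (j + suc j) * 4 + 1 ≡ 16 * suc j + 2
harmonic-second-time = solve-∀

harmonic-lap-time : ∀ j → 8 * suc j + 6 + (16 * suc j + 2) + ((j + j) * 4 + 1 + 1 + 1 + 1) ≡ 32 * suc j + 4
harmonic-lap-time = solve-∀

module Harmonic (j : ℕ) where

  k n : ℕ
  k = suc j
  n = 2 * k

  open Ant n (LR k)
  open L²ᵏR-Ant k

  j+k+1≡n : j + k + 1 ≡ n
  j+k+1≡n = trans (ℕ.+-comm (j + k) 1) k+k≡2k

  2+[j+j]≡n : 2 + (j + j) ≡ n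
  2+[j+j]≡n = trans (cong suc (sym (ℕ.+-suc j j))) k+k≡2k

  j+k<n : j + k < n
  j+k<n = ℕ.≤-reflexive k+k≡2k

  1<n : 1 < n
  1<n = ℕ.≤-trans (ℕ.m≤m+n 2 (j + j)) (ℕ.≤-reflexive 2+[j+j]≡n)

  j+j≤n : j + j ≤ n
  j+j≤n = ℕ.≤-trans (ℕ.m≤n+m (j + j) 2) (ℕ.≤-reflexive 2+[j+j]≡n)

  second-before-period : 8 * k + 6 + (16 * k + 2) < 32 * k + 4
  second-before-period =
    subst (8 * k + 6 + (16 * k + 2) <_) (harmonic-lap-time j) (ℕ.m<m+n _ (ℕ.m≤n+m 1 _))

  S₂ : List Pos
  S₂ = (0ℤ , 0ℤ) ∷ (0ℤ , 1ℤ) ∷ (-1ℤ , 1ℤ) ∷ (-1ℤ , 0ℤ) ∷ (0ℤ , -1ℤ) ∷ (1ℤ , -1ℤ) ∷ (1ℤ , 0ℤ)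
     ∷ (-1ℤ , -1ℤ) ∷ (1ℤ , 1ℤ) ∷ (1ℤ , 2ℤ) ∷ (0ℤ , 2ℤ) ∷ (2ℤ , 0ℤ) ∷ (2ℤ , 1ℤ) ∷ []

  κ₀ : Counts
  κ₀ = tabulated (((-1ℤ , -1ℤ) , n) ∷ ((0ℤ , -1ℤ) , j + k) ∷ [])

  open Moves S₂

  blank : ∀ {m} → m ≤ n → ∃[ v ] 0 ≋ v × v + m ≤ n
  blank m≤n = 0 , ≋-refl , m≤n

  wrapped : ∀ {c m} → c ≋ n → m ≤ n → ∃[ v ] c + 1 ≋ v × v + m ≤ n
  wrapped c≋n m≤n = 0 , ≋-wrap c≋n , m≤n

  first : ∃[ κ ] (κ₀ , (0ℤ , 0ℤ) , right) ⟶[ 8 * k + 6 ] (κ , (-1ℤ , -1ℤ) , left)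
  first = _ , retime (harmonic-first-time j)
    ( loop n (0ℤ , 0ℤ) right (blank ℕ.≤-refl ∷ blank ℕ.≤-refl ∷ blank ℕ.≤-refl ∷ blank ℕ.≤-refl ∷ [])
    ▸ turnR ≋-refl
    ▸ turnL (j + k) ≋-refl j+k<n
    ▸ turnL 0 ≋-refl z<s
    ▸ turnL 0 ≋-refl z<s
    ▸ turnL 0 (≋-wrap ≋-refl) z<s
    ▸ turnR (≡⇒≋ j+k+1≡n))

  second : ∃[ κ ] (proj₁ first , (-1ℤ , -1ℤ) , left) ⟶[ 16 * k + 2 ] (κ , (0ℤ , 0ℤ) , left)
  second = _ , retime (harmonic-second-time j)
    ( turnR ≋-refl
    ▸ turnR ≋-refl
    ▸ turnL 1 (≋-+ʳ 1 (≋-wrap ≋-refl)) 1<n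
    ▸ turnR ≋-refl
    ▸ loop n (1ℤ , 1ℤ) right (blank ℕ.≤-refl ∷ blank ℕ.≤-refl ∷ blank ℕ.≤-refl ∷ wrapped ≋-refl ℕ.≤-refl ∷ [])
    ▸ turnR ≋-refl
    ▸ loop (j + k) (1ℤ , 0ℤ) down ( (1 , ≋-refl , ℕ.≤-reflexive k+k≡2k)
                                  ∷ blank (ℕ.<⇒≤ j+k<n)
                                  ∷ blank (ℕ.<⇒≤ j+k<n)
                                  ∷ wrapped ≋-refl (ℕ.<⇒≤ j+k<n) ∷ [])
    ▸ turnR (≡⇒≋ k+k≡2k))

  third : ∃[ κ ] (proj₁ second , (0ℤ , 0ℤ) , left) ⟶[ (j + j) * 4 + 1 + 1 + 1 + 1 ] (κ , (2ℤ , 2ℤ) , right)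
  third = _ ,
    ( loop (j + j) (0ℤ , 0ℤ) left ( (2 , ≋-+ʳ 1 (≋-+ʳ 1 (≋-wrap ≋-refl)) , ℕ.≤-reflexive 2+[j+j]≡n)
                                  ∷ wrapped (≡⇒≋ j+k+1≡n) j+j≤n
                                  ∷ (1 , ≋-refl , ℕ.≤-trans (ℕ.n≤1+n _) (ℕ.≤-reflexive 2+[j+j]≡n))
                                  ∷ wrapped (≡⇒≋ k+k≡2k) j+j≤n ∷ [])
    ▸ turnR (≋-≡ (≋-+ʳ (j + j) (≋-+ʳ 1 (≋-+ʳ 1 (≋-wrap ≋-refl)))) 2+[j+j]≡n)
    ▸ turnR (≋-+ʳ n (≋-wrap ≋-refl))
    ▸ turnL (j + k) (≋-+ʳ (j + k) (≋-wrap ≋-refl)) j+k<n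
    ▸ turnR ≋-refl)

  H₂ : Highway n (LR k)
  H₂ = highway (retime (harmonic-lap-time j) (proj₂ first ▸ proj₂ second ▸ proj₂ third))
               (here refl) repeats
    where
    repeats : Repeats κ₀ (proj₁ third) (2ℤ , 2ℤ)
    repeats = refl ∷ refl ∷ refl
            ∷ sym (⟨⟩-≋ (≋-wrap ≋-refl))
            ∷ refl ∷ refl ∷ refl
            ∷ sym (⟨⟩-≋ (≋-≡ (≋-+ʳ 1 (≋-+ʳ (j + k) (≋-wrap ≋-refl))) j+k+1≡n))
            ∷ refl ∷ refl ∷ refl ∷ refl ∷ refl ∷ []

  H₂-periodic : Periodic (trace H₂) (period H₂)
  H₂-periodic = quadrant-trace-periodic H₂ (-1ℤ , -1ℤ)

  reads-n : trace H₂ (8 * k + 6) ≡ ⟨ n ⟩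
  reads-n = trans (trace-before-period H₂ (8 * k + 6) (ℕ.≤-<-trans (ℕ.m≤m+n _ _) second-before-period))
                  (reading-after (proj₂ first))

  reads-2 : trace H₂ (8 * k + 6 + (16 * k + 2)) ≡ ⟨ 2 ⟩
  reads-2 = trans (trace-before-period H₂ _ second-before-period)
            (trans (reading-after (proj₂ first ▸ proj₂ second))
                   (⟨⟩-≋ (≋-+ʳ 1 (≋-+ʳ 1 (≋-wrap ≋-refl)))))

  not-fundamentally-periodic : 1 ≤ j → trace H₂ (8 * k + 6 + (16 * k + 2)) ≢ trace H₂ (8 * k + 6)
  not-fundamentally-periodic 1≤j same = ℕ.<⇒≢ (ℕ.*-monoʳ-< 2 (s≤s 1≤j)) (begin
    2           ≡⟨ toℕ-⟨⟩-≋ ≋-refl 1<n ⟨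
    toℕ ⟨ 2 ⟩   ≡⟨ cong toℕ (trans (sym reads-2) (trans same reads-n)) ⟩
    toℕ ⟨ n ⟩   ≡⟨ toℕ-⟨⟩-≋ ≋-refl ℕ.≤-refl ⟩
    n           ∎)
    where open ≡-Reasoning

mainTheorem2 : ∀ (k : ℕ) → 1 < k →
    Σ[ H₁ ∈ Highway (2 * k) (LR k) ] Σ[ H₂ ∈ Highway (2 * k) (LR k) ]
    ( (period H₁ ≡ 16 * k + 2)
    × (∣ proj₁ (drift H₁) ∣ ≡ 1)
    × (∣ proj₂ (drift H₁) ∣ ≡ 1)
    × (period H₂ ≡ 32 * k + 4)
    × (∣ proj₁ (drift H₂) ∣ ≡ 2)
    × (∣ proj₂ (drift H₂) ∣ ≡ 2)
    × ¬ SameHighway (2 * k) (LR k) H₁ H₂ )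
mainTheorem2 (suc (suc i)) (s≤s (s≤s z≤n)) =
  H₁ , H₂ , refl , refl , refl , refl , refl , refl ,
  traces-distinguish H₁ H₂ H₁-periodic H₂-periodic (8 * suc (suc i) + 6)
                     (not-fundamentally-periodic (s≤s z≤n))
  where
  open Ant (2 * suc (suc i)) (LR (suc (suc i))) using (traces-distinguish)
  open Fundamental (suc i) using (H₁; H₁-periodic)
  open Harmonic (suc i) using (H₂; H₂-periodic; not-fundamentally-periodic)
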